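{- Let $i, j, k \in \mathbb{N}^+$ with $k > j > i$. Then the number of ways to split $2k+j$ balls into nonempty ordered bins (any number of bins) so that one bin has exactly $k$ balls and another bin has exactly $k+i$ balls is $$T_{2k+j,[k+i,k]} = \sum_{\ell=1}^{j-i} (\ell^2+3\ell+2)\binom{j-i-1}{\ell-1}.$$
   Context: $T_{2k+j,[k+i,k]}$ denotes the number of compositions of $2k+j$ (ordered tuples of positive integers, of any length, summing to $2k+j$) in which some part equals $k$ and some other part equals $k+i$. -}

module Defs where

open import Data.Nat using (ℕ; zero; suc; _+_; _*_; _∸_; _≤_; _<_; _≡ᵇ_)
open import Data.Nat.Combinatorics using (_C_)
open import Data.Nat.ListAction using (sum)
open import Data.List using (List; length; lookup; allFin)
open import Data.Bool.ListAction using (any)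
open import Data.List.Relation.Unary.All using (All)
open import Data.Fin using (Fin; _≟_)
open import Data.Bool using (Bool; T; _∧_; not)
open import Data.Product using (Σ; _×_)
open import Relation.Nullary using (does)
open import Relation.Binary.PropositionalEquality using (_≡_)

IsComposition : ℕ → List ℕ → Set
IsComposition n xs = All (λ x → 1 ≤ x) xs × sum xs ≡ n

hasParts : ℕ → ℕ → List ℕ → Bool
hasParts a b xs =
  any (λ p → (lookup xs p ≡ᵇ a) ∧
             any (λ q → not (does (p ≟ q)) ∧ (lookup xs q ≡ᵇ b)) (allFin (length xs)))
      (allFin (length xs))

-- The set of compositions of n having a part a and another part b.
-- (T is proposition-valued, so this is a set of lists.)
T-set : ℕ → ℕ → ℕ → Set
T-set n a b = Σ (List ℕ) (λ xs → IsComposition n xs × T (hasParts a b xs))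

sumFrom1 : ℕ → (ℕ → ℕ) → ℕ
sumFrom1 zero f = 0
sumFrom1 (suc m) f = sumFrom1 m f + f (suc m)

T-formula : ℕ → ℕ → ℕ
T-formula i j =
  sumFrom1 (j ∸ i) (λ ℓ → (ℓ * ℓ + 3 * ℓ + 2) * ((j ∸ i ∸ 1) C (ℓ ∸ 1)))

module Submission where

-- Put M = j - i, so that 2k + j = (k + i) + k + M with M < k < k + i. Deleting the part k + i
-- and the part k from a composition counted by T leaves a composition of M, say with ℓ parts,
-- in which neither k nor k + i can occur because M is too small; conversely the two parts can
-- be reinserted in (ℓ + 1)(ℓ + 2) = ℓ² + 3ℓ + 2 ways. Finally, M has C(M - 1, ℓ - 1)
-- compositions with ℓ parts: splitting off whether the first part is 1 yields Pascal's rule.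

open import Defs
open import Data.Nat
open import Data.Nat.Properties
open import Data.Nat.Combinatorics using (_C_; k>n⇒nCk≡0; nCk+nC[k+1]≡[n+1]C[k+1])
open import Data.Nat.ListAction using (sum)
open import Data.Nat.Tactic.RingSolver using (solve-∀)
open import Algebra.Properties.CommutativeSemigroup +-commutativeSemigroup
  using (interchange; x∙yz≈y∙xz)
open import Data.Bool using (T)
open import Data.Bool.Properties using (T-∧; T-not-≡; T-irrelevant)
open import Data.Fin using (Fin; toℕ; cast) renaming (_≟_ to _≟ᶠ_)
open import Data.Fin.Properties using (+↔⊎; *↔×; toℕ-cast; toℕ-injective; toℕ<n)
open import Data.List using (List; []; _∷_; length; lookup; allFin)
open import Data.List.Properties using (length-removeAt′)
open import Data.List.Relation.Unary.All as All using (All; []; _∷_)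
open import Data.List.Relation.Unary.All.Properties using (─⁺)
open import Data.List.Relation.Unary.Any using (here; there; index; _─_; satisfied)
open import Data.List.Relation.Unary.Any.Properties using (any⁺; any⁻; lookup-index)
open import Data.List.Membership.Propositional using (_∈_; _∉_; lose)
open import Data.List.Membership.Propositional.Properties using (∈-lookup; ∈-allFin)
open import Data.Product using (Σ; _×_; _,_; proj₁; proj₂)
open import Data.Sum using (_⊎_; inj₁; inj₂; [_,_]; map₂)
open import Data.Sum.Function.Propositional using (_⊎-↔_)
open import Function using (_∘_; Equivalence)
open import Function.Bundles using (_↔_; mk↔ₛ′)
open import Function.Properties.Inverse using (↔-sym; ↔-trans)
import Function.Related.Propositional as Related
open import Relation.Nullary using (contradiction)
open import Relation.Nullary.Decidable using (dec-false)
open import Relation.Binary.PropositionalEquality hiding ([_])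

sumFrom1-cong : ∀ M {f g : ℕ → ℕ} → (∀ ℓ → f (suc ℓ) ≡ g (suc ℓ)) →
                sumFrom1 M f ≡ sumFrom1 M g
sumFrom1-cong zero    f≗g = refl
sumFrom1-cong (suc M) f≗g = cong₂ _+_ (sumFrom1-cong M f≗g) (f≗g M)

sumFrom1-+ : ∀ M (f g : ℕ → ℕ) →
             sumFrom1 M (λ ℓ → f ℓ + g ℓ) ≡ sumFrom1 M f + sumFrom1 M g
sumFrom1-+ zero    f g = refl
sumFrom1-+ (suc M) f g =
  trans (cong (_+ (f (suc M) + g (suc M))) (sumFrom1-+ M f g))
        (interchange (sumFrom1 M f) (sumFrom1 M g) (f (suc M)) (g (suc M)))

sumFrom1-suc : ∀ M (f : ℕ → ℕ) → sumFrom1 (suc M) f ≡ f 1 + sumFrom1 M (f ∘ suc)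
sumFrom1-suc zero    f = +-comm 0 (f 1)
sumFrom1-suc (suc M) f =
  trans (cong (_+ f (suc (suc M))) (sumFrom1-suc M f)) (+-assoc (f 1) _ _)

sumFrom1-dropLast : ∀ M (f : ℕ → ℕ) → f (suc M) ≡ 0 → sumFrom1 (suc M) f ≡ sumFrom1 M f
sumFrom1-dropLast M f f[1+M]≡0 =
  trans (cong (sumFrom1 M f +_) f[1+M]≡0) (+-identityʳ (sumFrom1 M f))

-- The sum of h (length c) over all compositions c of N + 1, computed by splitting
-- on whether the first part of c is 1.
sumOverCompositions : ℕ → (ℕ → ℕ) → ℕ
sumOverCompositions zero    h = h 1
sumOverCompositions (suc N) h = sumOverCompositions N (h ∘ suc) + sumOverCompositions N h

sumOverCompositions-binomial : ∀ N h →
  sumOverCompositions N h ≡ sumFrom1 (suc N) (λ ℓ → h ℓ * (N C (ℓ ∸ 1)))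
sumOverCompositions-binomial zero    h = sym (*-identityʳ (h 1))
sumOverCompositions-binomial (suc N) h = begin
  sumOverCompositions N (h ∘ suc) + sumOverCompositions N h
    ≡⟨ cong₂ _+_ (sumOverCompositions-binomial N (h ∘ suc))
                 (trans (sumOverCompositions-binomial N h) (sumFrom1-suc N _)) ⟩
  A + (h 1 * 1 + sumFrom1 N X)
    ≡⟨ cong (λ s → A + (h 1 * 1 + s)) (sym (sumFrom1-dropLast N X X[1+N]≡0)) ⟩
  A + (h 1 * 1 + sumFrom1 (suc N) X)
    ≡⟨ x∙yz≈y∙xz A (h 1 * 1) _ ⟩
  h 1 * 1 + (A + sumFrom1 (suc N) X)
    ≡⟨ cong (h 1 * 1 +_) (sym (sumFrom1-+ (suc N) _ X)) ⟩
  h 1 * 1 + sumFrom1 (suc N) (λ ℓ → h (suc ℓ) * (N C (ℓ ∸ 1)) + X ℓ)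
    ≡⟨ cong (h 1 * 1 +_) (sumFrom1-cong (suc N) pascal) ⟩
  h 1 * 1 + sumFrom1 (suc N) (λ ℓ → h (suc ℓ) * (suc N C ℓ))
    ≡⟨ sym (sumFrom1-suc (suc N) _) ⟩
  sumFrom1 (suc (suc N)) (λ ℓ → h ℓ * (suc N C (ℓ ∸ 1))) ∎
  where
  open ≡-Reasoning
  A : ℕ
  A = sumFrom1 (suc N) (λ ℓ → h (suc ℓ) * (N C (ℓ ∸ 1)))
  X : ℕ → ℕ
  X ℓ = h (suc ℓ) * (N C ℓ)
  X[1+N]≡0 : X (suc N) ≡ 0
  X[1+N]≡0 = trans (cong (h (suc (suc N)) *_) (k>n⇒nCk≡0 (n<1+n N)))
                   (*-zeroʳ (h (suc (suc N))))
  pascal : ∀ ℓ → h (suc (suc ℓ)) * (N C ℓ) + X (suc ℓ) ≡ h (suc (suc ℓ)) * (suc N C suc ℓ)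
  pascal ℓ = trans (sym (*-distribˡ-+ (h (suc (suc ℓ))) _ _))
                   (cong (h (suc (suc ℓ)) *_) (nCk+nC[k+1]≡[n+1]C[k+1] N ℓ))

Composition : ℕ → Set
Composition s = Σ (List ℕ) (IsComposition s)

IsComposition-irrelevant : ∀ {s xs} (π π′ : IsComposition s xs) → π ≡ π′
IsComposition-irrelevant (pos , e) (pos′ , e′) =
  cong₂ _,_ (All.irrelevant ≤-irrelevant pos pos′) (≡-irrelevant e e′)

Decorated : (ℕ → Set) → ℕ → Set
Decorated F s = Σ (Composition s) (λ c → F (length (proj₁ c)))

Decorated-≡ : ∀ {F s xs} {π π′ : IsComposition s xs} {y : F (length xs)} →
              _≡_ {A = Decorated F s} ((xs , π) , y) ((xs , π′) , y)
Decorated-≡ {π = π} {π′} = cong (λ π″ → ((_ , π″) , _)) (IsComposition-irrelevant π π′)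

module _ (F : ℕ → Set) where

  Decorated-one : Decorated F 1 ↔ F 1
  Decorated-one = mk↔ₛ′ to from (λ _ → refl) from∘to
    where
    to : Decorated F 1 → F 1
    to ((1 ∷ [] , _) , y) = y
    to (([] , _ , ()) , _)
    to ((0 ∷ _ , () ∷ _ , _) , _)
    to ((1 ∷ 0 ∷ _ , _ ∷ () ∷ _ , _) , _)
    to ((1 ∷ suc _ ∷ _ , _ , ()) , _)
    to ((suc (suc _) ∷ _ , _ , ()) , _)

    from : F 1 → Decorated F 1
    from y = ((1 ∷ [] , s≤s z≤n ∷ [] , refl) , y)

    from∘to : ∀ c → from (to c) ≡ c
    from∘to ((1 ∷ [] , _) , y) = Decorated-≡ {F}
    from∘to (([] , _ , ()) , _)
    from∘to ((0 ∷ _ , () ∷ _ , _) , _)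
    from∘to ((1 ∷ 0 ∷ _ , _ ∷ () ∷ _ , _) , _)
    from∘to ((1 ∷ suc _ ∷ _ , _ , ()) , _)
    from∘to ((suc (suc _) ∷ _ , _ , ()) , _)

  Decorated-splitFirst : ∀ N →
    Decorated F (2 + N) ↔ (Decorated (F ∘ suc) (1 + N) ⊎ Decorated F (1 + N))
  Decorated-splitFirst N = mk↔ₛ′ to from to∘from from∘to
    where
    to : Decorated F (2 + N) → Decorated (F ∘ suc) (1 + N) ⊎ Decorated F (1 + N)
    to ((1 ∷ xs , _ ∷ pos , e) , y) = inj₁ ((xs , pos , suc-injective e) , y)
    to ((suc (suc x) ∷ xs , _ ∷ pos , e) , y) =
      inj₂ ((suc x ∷ xs , s≤s z≤n ∷ pos , suc-injective e) , y)
    to (([] , _ , ()) , _)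
    to ((0 ∷ _ , () ∷ _ , _) , _)

    from : Decorated (F ∘ suc) (1 + N) ⊎ Decorated F (1 + N) → Decorated F (2 + N)
    from (inj₁ ((xs , pos , e) , y)) = ((1 ∷ xs , s≤s z≤n ∷ pos , cong suc e) , y)
    from (inj₂ ((suc x ∷ xs , _ ∷ pos , e) , y)) =
      ((suc (suc x) ∷ xs , s≤s z≤n ∷ pos , cong suc e) , y)
    from (inj₂ (([] , _ , ()) , _))
    from (inj₂ ((0 ∷ _ , () ∷ _ , _) , _))

    to∘from : ∀ c → to (from c) ≡ c
    to∘from (inj₁ _) = cong inj₁ (Decorated-≡ {F ∘ suc})
    to∘from (inj₂ ((suc _ ∷ _ , _ ∷ _ , _) , _)) = cong inj₂ (Decorated-≡ {F})
    to∘from (inj₂ (([] , _ , ()) , _))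
    to∘from (inj₂ ((0 ∷ _ , () ∷ _ , _) , _))

    from∘to : ∀ c → from (to c) ≡ c
    from∘to ((1 ∷ _ , _ ∷ _ , _) , _) = Decorated-≡ {F}
    from∘to ((suc (suc _) ∷ _ , _ ∷ _ , _) , _) = Decorated-≡ {F}
    from∘to (([] , _ , ()) , _)
    from∘to ((0 ∷ _ , () ∷ _ , _) , _)

Decorated↔sumOverCompositions : ∀ N (F : ℕ → Set) (h : ℕ → ℕ) →
  (∀ L → F L ↔ Fin (h L)) → Decorated F (suc N) ↔ Fin (sumOverCompositions N h)
Decorated↔sumOverCompositions zero    F h F↔h = ↔-trans (Decorated-one F) (F↔h 1)
Decorated↔sumOverCompositions (suc N) F h F↔h =
  ↔-trans (Decorated-splitFirst F N)
  (↔-trans (Decorated↔sumOverCompositions N (F ∘ suc) (h ∘ suc) (F↔h ∘ suc)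
              ⊎-↔ Decorated↔sumOverCompositions N F h F↔h)
           (↔-sym (+↔⊎ {sumOverCompositions N (h ∘ suc)})))

-- A position past the end inserts at the end; only positions p ≤ length xs are used.
insertAt : {A : Set} → List A → ℕ → A → List A
insertAt xs       zero    v = v ∷ xs
insertAt []       (suc p) v = v ∷ []
insertAt (x ∷ xs) (suc p) v = x ∷ insertAt xs p v

module _ {A : Set} where

  length-insertAt : ∀ (xs : List A) p v → length (insertAt xs p v) ≡ suc (length xs)
  length-insertAt xs       zero    v = refl
  length-insertAt []       (suc p) v = refl
  length-insertAt (x ∷ xs) (suc p) v = cong suc (length-insertAt xs p v)

  All-insertAt : ∀ {P : A → Set} {v} xs p → P v → All P xs → All P (insertAt xs p v)
  All-insertAt xs       zero    pv pxs        = pv ∷ pxs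
  All-insertAt []       (suc p) pv []         = pv ∷ []
  All-insertAt (x ∷ xs) (suc p) pv (px ∷ pxs) = px ∷ All-insertAt xs p pv pxs

  ∈-insertAt : ∀ (xs : List A) p v → v ∈ insertAt xs p v
  ∈-insertAt xs       zero    v = here refl
  ∈-insertAt []       (suc p) v = here refl
  ∈-insertAt (x ∷ xs) (suc p) v = there (∈-insertAt xs p v)

  ∈-insertAt⁺ : ∀ {u : A} {xs} p v → u ∈ xs → u ∈ insertAt xs p v
  ∈-insertAt⁺ zero    v u∈         = there u∈
  ∈-insertAt⁺ (suc p) v (here e)   = here e
  ∈-insertAt⁺ (suc p) v (there u∈) = there (∈-insertAt⁺ p v u∈)

  ∈-insertAt⁻ : ∀ {u : A} xs p v → u ∈ insertAt xs p v → u ≡ v ⊎ u ∈ xs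
  ∈-insertAt⁻ xs       zero    v (here e)   = inj₁ e
  ∈-insertAt⁻ xs       zero    v (there u∈) = inj₂ u∈
  ∈-insertAt⁻ []       (suc p) v (here e)   = inj₁ e
  ∈-insertAt⁻ (x ∷ xs) (suc p) v (here e)   = inj₂ (here e)
  ∈-insertAt⁻ (x ∷ xs) (suc p) v (there u∈) = map₂ there (∈-insertAt⁻ xs p v u∈)

  ∈-─⁺ : ∀ {u v : A} {xs} → u ≢ v → u ∈ xs → (v∈ : v ∈ xs) → u ∈ (xs ─ v∈)
  ∈-─⁺ u≢v (here refl) (here refl) = contradiction refl u≢v
  ∈-─⁺ u≢v (there u∈)  (here refl) = u∈
  ∈-─⁺ u≢v (here e)    (there v∈)  = here e
  ∈-─⁺ u≢v (there u∈)  (there v∈)  = there (∈-─⁺ u≢v u∈ v∈)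

  insertAt-─ : ∀ {v : A} {xs} (v∈ : v ∈ xs) → insertAt (xs ─ v∈) (toℕ (index v∈)) v ≡ xs
  insertAt-─ (here refl) = refl
  insertAt-─ (there v∈)  = cong (_ ∷_) (insertAt-─ v∈)

  -- Where v does not occur in xs, the only occurrence of v in insertAt xs p v is the
  -- inserted one, so removing any occurrence undoes the insertion.
  ─-insertAt : ∀ {v : A} {xs zs} p → v ∉ xs → p ≤ length xs → zs ≡ insertAt xs p v →
               (v∈ : v ∈ zs) → toℕ (index v∈) ≡ p × (zs ─ v∈) ≡ xs
  ─-insertAt zero v∉ _ refl (here refl) = refl , refl
  ─-insertAt zero v∉ _ refl (there v∈)  = contradiction v∈ v∉
  ─-insertAt {xs = x ∷ xs} (suc p) v∉ _ refl (here v≡x) = contradiction (here v≡x) v∉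
  ─-insertAt {xs = x ∷ xs} (suc p) v∉ (s≤s p≤) refl (there v∈) =
    let index≡p , ─≡xs = ─-insertAt p (v∉ ∘ there) p≤ refl v∈
    in cong suc index≡p , cong (x ∷_) ─≡xs

sum-insertAt : ∀ xs p v → sum (insertAt xs p v) ≡ v + sum xs
sum-insertAt xs       zero    v = refl
sum-insertAt []       (suc p) v = refl
sum-insertAt (x ∷ xs) (suc p) v =
  trans (cong (x +_) (sum-insertAt xs p v)) (x∙yz≈y∙xz x v (sum xs))

sum-─ : ∀ {v xs} (v∈ : v ∈ xs) → sum xs ≡ v + sum (xs ─ v∈)
sum-─ (here refl) = refl
sum-─ {v} {x ∷ xs} (there v∈) =
  trans (cong (x +_) (sum-─ v∈)) (x∙yz≈y∙xz x v (sum (xs ─ v∈)))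

∈⇒≤sum : ∀ {v xs} → v ∈ xs → v ≤ sum xs
∈⇒≤sum {xs = x ∷ xs} (here refl) = m≤m+n x (sum xs)
∈⇒≤sum {xs = x ∷ xs} (there v∈)  = ≤-trans (∈⇒≤sum v∈) (m≤n+m (sum xs) x)

hasParts⇒∈ : ∀ {a b xs} → T (hasParts a b xs) → a ∈ xs × b ∈ xs
hasParts⇒∈ {xs = xs} t =
  let p , p-ok = satisfied (any⁻ _ (allFin (length xs)) t)
      xs[p]≡a , q-ok = Equivalence.to T-∧ p-ok
      q , q-ok′ = satisfied (any⁻ _ (allFin (length xs)) q-ok)
      xs[q]≡b = proj₂ (Equivalence.to T-∧ q-ok′)
  in lookup-∈ p (≡ᵇ⇒≡ _ _ xs[p]≡a) , lookup-∈ q (≡ᵇ⇒≡ _ _ xs[q]≡b)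
  where
  lookup-∈ : ∀ {v} p → lookup xs p ≡ v → v ∈ xs
  lookup-∈ p e = subst (_∈ xs) e (∈-lookup p)

∈⇒hasParts : ∀ {a b xs} → a ≢ b → a ∈ xs → b ∈ xs → T (hasParts a b xs)
∈⇒hasParts {xs = xs} a≢b a∈ b∈ =
  any⁺ _ (lose (∈-allFin (index a∈)) (Equivalence.from T-∧
    ( ≡⇒≡ᵇ _ _ (sym (lookup-index a∈))
    , any⁺ _ (lose (∈-allFin (index b∈)) (Equivalence.from T-∧
        ( Equivalence.from T-not-≡ (dec-false (index a∈ ≟ᶠ index b∈) distinct)
        , ≡⇒≡ᵇ _ _ (sym (lookup-index b∈)) ))) )))
  where
  distinct : index a∈ ≢ index b∈
  distinct e =
    a≢b (trans (lookup-index a∈) (trans (cong (lookup xs) e) (sym (lookup-index b∈))))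

-- The positions at which the part a, and then the part b, are inserted into a composition
-- with L parts.
InsertionSlots : ℕ → Set
InsertionSlots L = Fin (suc L) × Fin (suc (suc L))

module _ {a b m : ℕ} (m<a : m < a) (m<b : m < b) (a≢b : a ≢ b) where

  private
    sum<⇒∉ : ∀ {v c} → m < v → sum c ≡ m → v ∉ c
    sum<⇒∉ m<v sum≡m v∈ = <⇒≱ m<v (subst (_ ≤_) sum≡m (∈⇒≤sum v∈))

    module Removal (x : T-set (a + b + m) a b) where
      xs : List ℕ
      xs = proj₁ x

      sum≡ : sum xs ≡ a + b + m
      sum≡ = proj₂ (proj₁ (proj₂ x))

      t : T (hasParts a b xs)
      t = proj₂ (proj₂ x)

      b∈xs : b ∈ xs
      b∈xs = proj₂ (hasParts⇒∈ t)

      ys : List ℕ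
      ys = xs ─ b∈xs

      a∈ys : a ∈ ys
      a∈ys = ∈-─⁺ a≢b (proj₁ (hasParts⇒∈ t)) b∈xs

      c : List ℕ
      c = ys ─ a∈ys

      length-ys : length ys ≡ suc (length c)
      length-ys = length-removeAt′ ys (index a∈ys)

      length-xs : length xs ≡ suc (suc (length c))
      length-xs = trans (length-removeAt′ xs (index b∈xs)) (cong suc length-ys)

      sum-c : sum c ≡ m
      sum-c = +-cancelˡ-≡ (b + a) _ _ (begin
        b + a + sum c     ≡⟨ +-assoc b a (sum c) ⟩
        b + (a + sum c)   ≡⟨ cong (b +_) (sum-─ a∈ys) ⟨
        b + sum ys        ≡⟨ sum-─ b∈xs ⟨
        sum xs            ≡⟨ sum≡ ⟩
        a + b + m         ≡⟨ cong (_+ m) (+-comm a b) ⟩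
        b + a + m         ∎)
        where open ≡-Reasoning

      p : Fin (suc (length c))
      p = cast length-ys (index a∈ys)

      q : Fin (suc (suc (length c)))
      q = cast length-xs (index b∈xs)

      reinsert : insertAt (insertAt c (toℕ p) a) (toℕ q) b ≡ xs
      reinsert = begin
        insertAt (insertAt c (toℕ p) a) (toℕ q) b
          ≡⟨ cong₂ (λ zs r → insertAt zs r b)
                   (trans (cong (λ r → insertAt c r a) (toℕ-cast length-ys (index a∈ys)))
                          (insertAt-─ a∈ys))
                   (toℕ-cast length-xs (index b∈xs)) ⟩
        insertAt ys (toℕ (index b∈xs)) b
          ≡⟨ insertAt-─ b∈xs ⟩
        xs ∎
        where open ≡-Reasoning

    Slots-≡ : ∀ {xs xs′ π π′} {p : Fin (suc (length xs))} {p′ : Fin (suc (length xs′))}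
                {q : Fin (suc (suc (length xs)))} {q′ : Fin (suc (suc (length xs′)))} →
              xs ≡ xs′ → toℕ p ≡ toℕ p′ → toℕ q ≡ toℕ q′ →
              _≡_ {A = Decorated InsertionSlots m} ((xs , π) , p , q) ((xs′ , π′) , p′ , q′)
    Slots-≡ {π = π} {π′} refl p≡p′ q≡q′
      rewrite IsComposition-irrelevant π π′ | toℕ-injective p≡p′ | toℕ-injective q≡q′ = refl

    T-set-≡ : ∀ {n xs xs′} {π : IsComposition n xs × T (hasParts a b xs)} {π′} →
              xs ≡ xs′ → _≡_ {A = T-set n a b} (xs , π) (xs′ , π′)
    T-set-≡ {π = π , t} {π′ , t′} refl
      rewrite IsComposition-irrelevant π π′ | T-irrelevant t t′ = refl

  T-set↔Decorated : T-set (a + b + m) a b ↔ Decorated InsertionSlots m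
  T-set↔Decorated = mk↔ₛ′ to from to∘from from∘to
    where
    to : T-set (a + b + m) a b → Decorated InsertionSlots m
    to x@(_ , (pos , _) , _) = ((c , ─⁺ a∈ys (─⁺ b∈xs pos) , sum-c) , p , q)
      where open Removal x

    from : Decorated InsertionSlots m → T-set (a + b + m) a b
    from ((c , pos , sum≡) , p , q) =
      insertAt ys (toℕ q) b ,
      ( ( All-insertAt ys (toℕ q) (≤-trans (s≤s z≤n) m<b)
            (All-insertAt c (toℕ p) (≤-trans (s≤s z≤n) m<a) pos)
        , sum-xs )
      , ∈⇒hasParts a≢b (∈-insertAt⁺ (toℕ q) b (∈-insertAt c (toℕ p) a)) (∈-insertAt ys (toℕ q) b) )
      where
      ys : List ℕ
      ys = insertAt c (toℕ p) a
      sum-xs : sum (insertAt ys (toℕ q) b) ≡ a + b + m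
      sum-xs = begin
        sum (insertAt ys (toℕ q) b) ≡⟨ sum-insertAt ys (toℕ q) b ⟩
        b + sum ys                  ≡⟨ cong (b +_) (sum-insertAt c (toℕ p) a) ⟩
        b + (a + sum c)             ≡⟨ x∙yz≈y∙xz b a (sum c) ⟩
        a + (b + sum c)             ≡⟨ +-assoc a b (sum c) ⟨
        a + b + sum c               ≡⟨ cong (a + b +_) sum≡ ⟩
        a + b + m                   ∎
        where open ≡-Reasoning

    from∘to : ∀ x → from (to x) ≡ x
    from∘to x = T-set-≡ reinsert
      where open Removal x

    to∘from : ∀ y → to (from y) ≡ y
    to∘from y@((c₀ , pos , sum≡) , p₀ , q₀) =
      Slots-≡ c≡c₀ (trans (toℕ-cast length-ys (index a∈ys)) index-a≡p₀)
                   (trans (toℕ-cast length-xs (index b∈xs)) index-b≡q₀)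
      where
      open Removal (from y) using (ys; a∈ys; b∈xs; c; length-ys; length-xs)
      ys₀ : List ℕ
      ys₀ = insertAt c₀ (toℕ p₀) a
      b∉ys₀ : b ∉ ys₀
      b∉ys₀ b∈ = [ a≢b ∘ sym , sum<⇒∉ m<b sum≡ ] (∈-insertAt⁻ c₀ (toℕ p₀) a b∈)
      q₀≤ : toℕ q₀ ≤ length ys₀
      q₀≤ = subst (toℕ q₀ ≤_) (sym (length-insertAt c₀ (toℕ p₀) a)) (≤-pred (toℕ<n q₀))
      b-removed : toℕ (index b∈xs) ≡ toℕ q₀ × ys ≡ ys₀
      b-removed = ─-insertAt (toℕ q₀) b∉ys₀ q₀≤ refl b∈xs
      index-b≡q₀ : toℕ (index b∈xs) ≡ toℕ q₀
      index-b≡q₀ = proj₁ b-removed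
      a-removed : toℕ (index a∈ys) ≡ toℕ p₀ × c ≡ c₀
      a-removed = ─-insertAt (toℕ p₀) (sum<⇒∉ m<a sum≡) (≤-pred (toℕ<n p₀)) (proj₂ b-removed) a∈ys
      index-a≡p₀ : toℕ (index a∈ys) ≡ toℕ p₀
      index-a≡p₀ = proj₁ a-removed
      c≡c₀ : c ≡ c₀
      c≡c₀ = proj₂ a-removed

n∸m≡1+[n∸1+m] : ∀ {m n} → m < n → n ∸ m ≡ suc (n ∸ suc m)
n∸m≡1+[n∸1+m] {zero}  {suc n} _         = refl
n∸m≡1+[n∸1+m] {suc m} {suc n} (s≤s m<n) = n∸m≡1+[n∸1+m] m<n

T-formula≡sumOverCompositions : ∀ {i j} → i < j →
  T-formula i j ≡ sumOverCompositions (j ∸ suc i) (λ L → suc L * suc (suc L))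
T-formula≡sumOverCompositions {i} {j} i<j = begin
  T-formula i j
    ≡⟨ cong (λ M → sumFrom1 M (λ ℓ → (ℓ * ℓ + 3 * ℓ + 2) * ((M ∸ 1) C (ℓ ∸ 1))))
            (n∸m≡1+[n∸1+m] i<j) ⟩
  sumFrom1 (suc N) (λ ℓ → (ℓ * ℓ + 3 * ℓ + 2) * (N C (ℓ ∸ 1)))
    ≡⟨ sumFrom1-cong (suc N) (λ ℓ → cong (_* (N C ℓ)) (quadratic (suc ℓ))) ⟨
  sumFrom1 (suc N) (λ ℓ → suc ℓ * suc (suc ℓ) * (N C (ℓ ∸ 1)))
    ≡⟨ sumOverCompositions-binomial N _ ⟨
  sumOverCompositions N (λ L → suc L * suc (suc L)) ∎
  where
  open ≡-Reasoning
  N : ℕ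
  N = j ∸ suc i
  quadratic : ∀ ℓ → suc ℓ * suc (suc ℓ) ≡ ℓ * ℓ + 3 * ℓ + 2
  quadratic = solve-∀

mainTheorem7 : (i j k : ℕ) → 0 < i → i < j → j < k →
    T-set (2 * k + j) (k + i) k ↔ Fin (T-formula i j)
mainTheorem7 i j k 0<i i<j j<k = begin
  T-set (2 * k + j) (k + i) k
    ≡⟨ cong (λ n → T-set n (k + i) k) 2k+j≡k+i+k+M ⟩
  T-set (k + i + k + M) (k + i) k
    ↔⟨ T-set↔Decorated M<k+i M<k k+i≢k ⟩
  Decorated InsertionSlots M
    ≡⟨ cong (Decorated InsertionSlots) M≡1+N ⟩
  Decorated InsertionSlots (suc N)
    ↔⟨ Decorated↔sumOverCompositions N InsertionSlots _ (λ _ → ↔-sym *↔×) ⟩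
  Fin (sumOverCompositions N (λ L → suc L * suc (suc L)))
    ≡⟨ cong Fin (T-formula≡sumOverCompositions i<j) ⟨
  Fin (T-formula i j) ∎
  where
  open Related.EquationalReasoning {k = Related.bijection}
  M N : ℕ
  M = j ∸ i
  N = j ∸ suc i
  M≡1+N : M ≡ suc N
  M≡1+N = n∸m≡1+[n∸1+m] i<j
  M<k : M < k
  M<k = ≤-<-trans (m∸n≤m j i) j<k
  M<k+i : M < k + i
  M<k+i = ≤-trans M<k (m≤m+n k i)
  k+i≢k : k + i ≢ k
  k+i≢k = >⇒≢ (m<m+n k 0<i)
  2k+j≡k+i+k+M : 2 * k + j ≡ k + i + k + M
  2k+j≡k+i+k+M = trans (cong (2 * k +_) (sym (m+[n∸m]≡n (<⇒≤ i<j)))) (rearrange k i M)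
    where
    rearrange : ∀ k i d → 2 * k + (i + d) ≡ k + i + k + d
    rearrange = solve-∀
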